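{- Let $\mathbf A$ be a Łukasiewicz near semiring and $a\in A$. Then the least ideal $I(a)$ of $\mathbf A$ containing $a$ is $I(a)=\{p(a): p\in \mathrm{Pol}_1(\mathbf A),\ p(0)=0\}$.
   Context: An $\iota$-near semiring is an algebra $\langle A,+,\cdot,{}^{\alpha},0,1\rangle$ of type $\langle 2,2,1,0,0\rangle$ such that $\langle A,+\rangle$ is a join semilattice with least element $0$ and greatest element $1$ (order $x\le y$ iff $x+y=y$), $x\cdot1=x=1\cdot x$, $(x+y)\cdot z=xz+yz$, $x0=0x=0$, $(x^{\alpha})^{\alpha}=x$, and $x\le y$ implies $y^{\alpha}\le x^{\alpha}$. A Łukasiewicz near semiring is an $\iota$-near semiring satisfying $(x y^{\alpha})^{\alpha} y^{\alpha}=(y x^{\alpha})^{\alpha} x^{\alpha}$. Juxtaposition $xy$ denotes $x\cdot y$. An ideal of $\mathbf A$ is a set $I\subseteq A$ with $0\in I$ such that (I1) if $ab^{\alpha}\in I$ and $b\in I$ then $a\in I$; (I2) if $a^{\alpha}b\in I$ and $b^{\alpha}a\in I$ then $(ac)^{\alpha}(bc)\in I$ and $(ca)^{\alpha}(cb)\in I$ for every $c\in A$. $\mathrm{Pol}_1(\mathbf A)$ is the set of unary polynomials of $\mathbf A$, i.e. functions $x\mapsto t^{\mathbf A}(x,e_1,\dots,e_n)$ with $t$ an $(n+1)$-ary term in the signature $(+,\cdot,{}^{\alpha},0,1)$ and $e_1,\dots,e_n\in A$. -}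

module Defs where

open import Data.Nat using (ℕ; suc)
open import Data.Fin using (Fin; zero; suc)
open import Data.Product using (Σ; ∃; _×_; _,_)
open import Data.Vec.Functional using (Vector; _∷_)
open import Relation.Binary.PropositionalEquality using (_≡_)
open import Relation.Unary using (Pred; _∈_; _⊆_)

record ŁukNearSemiring : Set₁ where
  infixl 6 _+_
  infixl 7 _·_
  field
    Carrier : Set
    _+_ : Carrier → Carrier → Carrier
    _·_ : Carrier → Carrier → Carrier
    _ᵅ : Carrier → Carrier
    𝟘 : Carrier
    𝟙 : Carrier

  _≤_ : Carrier → Carrier → Set
  x ≤ y = x + y ≡ y

  field
    +-assoc : ∀ x y z → (x + y) + z ≡ x + (y + z)
    +-comm  : ∀ x y → x + y ≡ y + x
    +-idem  : ∀ x → x + x ≡ x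
    𝟘-least : ∀ x → 𝟘 ≤ x
    𝟙-greatest : ∀ x → x ≤ 𝟙
    ·-identityʳ : ∀ x → x · 𝟙 ≡ x
    ·-identityˡ : ∀ x → 𝟙 · x ≡ x
    ·-distribʳ-+ : ∀ x y z → (x + y) · z ≡ (x · z) + (y · z)
    ·-zeroʳ : ∀ x → x · 𝟘 ≡ 𝟘
    ·-zeroˡ : ∀ x → 𝟘 · x ≡ 𝟘
    ᵅ-involutive : ∀ x → (x ᵅ) ᵅ ≡ x
    ᵅ-antitone : ∀ x y → x ≤ y → (y ᵅ) ≤ (x ᵅ)
    łuk : ∀ x y → ((x · (y ᵅ)) ᵅ) · (y ᵅ) ≡ ((y · (x ᵅ)) ᵅ) · (x ᵅ)

data Term (n : ℕ) : Set where
  var : Fin n → Term n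
  _⊕_ : Term n → Term n → Term n
  _⊗_ : Term n → Term n → Term n
  _′  : Term n → Term n
  t0  : Term n
  t1  : Term n

module _ (𝐀 : ŁukNearSemiring) where
  open ŁukNearSemiring 𝐀

  ⟦_⟧ : ∀ {n} → Term n → Vector Carrier n → Carrier
  ⟦ var i ⟧ ρ = ρ i
  ⟦ s ⊕ t ⟧ ρ = ⟦ s ⟧ ρ + ⟦ t ⟧ ρ
  ⟦ s ⊗ t ⟧ ρ = ⟦ s ⟧ ρ · ⟦ t ⟧ ρ
  ⟦ t ′ ⟧ ρ = (⟦ t ⟧ ρ) ᵅ
  ⟦ t0 ⟧ ρ = 𝟘
  ⟦ t1 ⟧ ρ = 𝟙

  IsPol₁ : (Carrier → Carrier) → Set
  IsPol₁ p = Σ ℕ λ n → Σ (Term (suc n)) λ t → Σ (Vector Carrier n) λ e →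
               ∀ x → p x ≡ ⟦ t ⟧ (x ∷ e)

  IsIdeal : Pred Carrier _ → Set
  IsIdeal I =
    (𝟘 ∈ I)
    × (∀ a b → (a · (b ᵅ)) ∈ I → b ∈ I → a ∈ I)
    × (∀ a b → ((a ᵅ) · b) ∈ I → ((b ᵅ) · a) ∈ I →
         ∀ c → (((a · c) ᵅ) · (b · c)) ∈ I × (((c · a) ᵅ) · (c · b)) ∈ I)

  PolSet : Carrier → Pred Carrier _
  PolSet a y = Σ (Carrier → Carrier) λ p → IsPol₁ p × p 𝟘 ≡ 𝟘 × p a ≡ y

  IsLeastIdealContaining : Carrier → Pred Carrier _ → Set₁
  IsLeastIdealContaining a I =
    IsIdeal I × a ∈ I × (∀ (J : Pred Carrier _) → IsIdeal J → a ∈ J → I ⊆ J)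

module Submission where

-- * Minimality.  An ideal J induces the relation  x θ y ⇔ xᵅy ∈ J ∧ yᵅx ∈ J.
--   Axiom (I2) makes θ compatible with multiplication, the involution turns
--   it into a congruence for ᵅ, and the join formula x + y = ((xyᵅ)ᵅyᵅ)ᵅ
--   reduces + to · and ᵅ; so θ is a congruence and every polynomial
--   preserves it.  If a ∈ J then a θ 0, hence p(a) θ p(0) = 0, and since
--   J is a θ-class of 0 (by (I1)) we get p(a) ∈ J.
--
-- * I(a) is an ideal.  Unary polynomials are closed under constants, the
--   identity, · and ᵅ.  Both ideal axioms are then verified for I(a) by
--   exhibiting explicit polynomials, using x·xᵅ = 0, the join formula and
--   the Łukasiewicz identity.

open import Defs
open import Data.Nat as ℕ using (suc)
open import Data.Fin using (Fin; zero; suc; _↑ˡ_; _↑ʳ_; lift)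
open import Data.Product using (_×_; _,_; proj₁; proj₂)
open import Data.Vec.Functional using (Vector; _∷_; _++_)
open import Data.Vec.Functional.Properties using (lookup-++ˡ; lookup-++ʳ)
open import Function using (_∘_)
open import Relation.Binary.PropositionalEquality
  using (_≡_; refl; sym; trans; cong; cong₂; subst; subst₂; module ≡-Reasoning)
open import Relation.Unary using (Pred; _∈_; _⊆_)

module _ (𝐀 : ŁukNearSemiring) where
  open ŁukNearSemiring 𝐀
  open ≡-Reasoning

  ≤-antisym : ∀ {x y} → x ≤ y → y ≤ x → x ≡ y
  ≤-antisym {x} {y} x≤y y≤x = trans (sym y≤x) (trans (+-comm y x) x≤y)

  ≤-lub : ∀ {x y z} → x ≤ z → y ≤ z → (x + y) ≤ z
  ≤-lub {x} {y} {z} x≤z y≤z = trans (+-assoc x y z) (trans (cong (x +_) y≤z) x≤z)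

  x≤x+y : ∀ x y → x ≤ (x + y)
  x≤x+y x y = trans (sym (+-assoc x x y)) (cong (_+ y) (+-idem x))

  y≤x+y : ∀ x y → y ≤ (x + y)
  y≤x+y x y = subst (y ≤_) (+-comm y x) (x≤x+y y x)

  ≤𝟘⇒≡𝟘 : ∀ {x} → x ≤ 𝟘 → x ≡ 𝟘
  ≤𝟘⇒≡𝟘 {x} x≤𝟘 = trans (sym (𝟘-least x)) (trans (+-comm 𝟘 x) x≤𝟘)

  -- Right distributivity makes multiplication monotone on the left.
  ·-monoˡ-≤ : ∀ {x y} z → x ≤ y → (x · z) ≤ (y · z)
  ·-monoˡ-≤ {x} {y} z x≤y = trans (sym (·-distribʳ-+ x y z)) (cong (_· z) x≤y)

  ·-decreasingˡ : ∀ x y → (x · y) ≤ y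
  ·-decreasingˡ x y = subst ((x · y) ≤_) (·-identityˡ y) (·-monoˡ-≤ y (𝟙-greatest x))

  ᵅ-swap : ∀ {x y} → x ᵅ ≡ y → x ≡ y ᵅ
  ᵅ-swap {x} xᵅ≡y = trans (sym (ᵅ-involutive x)) (cong _ᵅ xᵅ≡y)

  𝟘ᵅ≡𝟙 : 𝟘 ᵅ ≡ 𝟙
  𝟘ᵅ≡𝟙 = ≤-antisym (𝟙-greatest (𝟘 ᵅ))
    (subst (_≤ (𝟘 ᵅ)) (ᵅ-involutive 𝟙) (ᵅ-antitone 𝟘 (𝟙 ᵅ) (𝟘-least (𝟙 ᵅ))))

  𝟙ᵅ≡𝟘 : 𝟙 ᵅ ≡ 𝟘
  𝟙ᵅ≡𝟘 = sym (ᵅ-swap 𝟘ᵅ≡𝟙)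

  𝟘ᵅ-identityˡ : ∀ x → 𝟘 ᵅ · x ≡ x
  𝟘ᵅ-identityˡ x = trans (cong (_· x) 𝟘ᵅ≡𝟙) (·-identityˡ x)

  -- x ᵅ is a right and a left "complement": the Łukasiewicz identity with y = 1.
  ·-inverseʳ : ∀ x → x · x ᵅ ≡ 𝟘
  ·-inverseʳ x = begin
    x · x ᵅ                  ≡⟨ cong (_· x ᵅ) (sym (ᵅ-involutive x)) ⟩
    (x ᵅ) ᵅ · x ᵅ            ≡⟨ cong (λ w → w ᵅ · x ᵅ) (sym (·-identityˡ (x ᵅ))) ⟩
    (𝟙 · x ᵅ) ᵅ · x ᵅ        ≡⟨ sym (łuk x 𝟙) ⟩
    (x · 𝟙 ᵅ) ᵅ · 𝟙 ᵅ        ≡⟨ cong ((x · 𝟙 ᵅ) ᵅ ·_) 𝟙ᵅ≡𝟘 ⟩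
    (x · 𝟙 ᵅ) ᵅ · 𝟘          ≡⟨ ·-zeroʳ _ ⟩
    𝟘                        ∎

  ·-inverseˡ : ∀ x → x ᵅ · x ≡ 𝟘
  ·-inverseˡ x = subst (λ w → x ᵅ · w ≡ 𝟘) (ᵅ-involutive x) (·-inverseʳ (x ᵅ))

  ≤⇒·ᵅ≡𝟘 : ∀ {x y} → x ≤ y → x · y ᵅ ≡ 𝟘
  ≤⇒·ᵅ≡𝟘 {x} {y} x≤y =
    ≤𝟘⇒≡𝟘 (subst ((x · y ᵅ) ≤_) (·-inverseʳ y) (·-monoˡ-≤ (y ᵅ) x≤y))

  łuk-ᵅ : ∀ x y → (x ᵅ · y) ᵅ · y ≡ (y ᵅ · x) ᵅ · x
  łuk-ᵅ x y = subst₂ (λ s t → (x ᵅ · s) ᵅ · s ≡ (y ᵅ · t) ᵅ · t)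
                (ᵅ-involutive y) (ᵅ-involutive x) (łuk (x ᵅ) (y ᵅ))

  ᵅ-join : ∀ x y → (x + y) ᵅ ≡ (x · y ᵅ) ᵅ · y ᵅ
  ᵅ-join x y = ≤-antisym upper lower
    where
    s = (x · y ᵅ) ᵅ · y ᵅ

    y≤sᵅ : y ≤ (s ᵅ)
    y≤sᵅ = subst (_≤ (s ᵅ)) (ᵅ-involutive y) (ᵅ-antitone _ _ (·-decreasingˡ _ (y ᵅ)))

    x≤sᵅ : x ≤ (s ᵅ)
    x≤sᵅ = subst (λ w → x ≤ (w ᵅ)) (sym (łuk x y))
             (subst (_≤ (((y · x ᵅ) ᵅ · x ᵅ) ᵅ)) (ᵅ-involutive x)
               (ᵅ-antitone _ _ (·-decreasingˡ _ (x ᵅ))))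

    lower : s ≤ ((x + y) ᵅ)
    lower = subst (_≤ ((x + y) ᵅ)) (ᵅ-involutive s)
              (ᵅ-antitone _ _ (≤-lub x≤sᵅ y≤sᵅ))

    z = x + y

    łuk-z : (z · y ᵅ) ᵅ · y ᵅ ≡ z ᵅ
    łuk-z = begin
      (z · y ᵅ) ᵅ · y ᵅ   ≡⟨ łuk z y ⟩
      (y · z ᵅ) ᵅ · z ᵅ   ≡⟨ cong (λ w → w ᵅ · z ᵅ) (≤⇒·ᵅ≡𝟘 (y≤x+y x y)) ⟩
      𝟘 ᵅ · z ᵅ           ≡⟨ 𝟘ᵅ-identityˡ (z ᵅ) ⟩
      z ᵅ                 ∎

    upper : (z ᵅ) ≤ s
    upper = subst (_≤ s) łuk-z
              (·-monoˡ-≤ (y ᵅ) (ᵅ-antitone _ _ (·-monoˡ-≤ (y ᵅ) (x≤x+y x y))))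

  join-formula : ∀ x y → x + y ≡ ((x · y ᵅ) ᵅ · y ᵅ) ᵅ
  join-formula x y = ᵅ-swap (ᵅ-join x y)

  -- Term evaluation in A, and renaming of variables; these are what is
  -- needed to merge the parameter lists of two unary polynomials.
  eval : ∀ {n} → Term n → Vector Carrier n → Carrier
  eval = ⟦_⟧ 𝐀

  rename : ∀ {m n} → (Fin m → Fin n) → Term m → Term n
  rename ρ (var i) = var (ρ i)
  rename ρ (s ⊕ t) = rename ρ s ⊕ rename ρ t
  rename ρ (s ⊗ t) = rename ρ s ⊗ rename ρ t
  rename ρ (t ′)   = rename ρ t ′
  rename ρ t0      = t0
  rename ρ t1      = t1

  -- Evaluating a renamed term is evaluating the term in the pulled-back
  -- environment (given pointwise, as there is no function extensionality).
  eval-rename : ∀ {m n} (ρ : Fin m → Fin n) (t : Term m)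
                {σ : Vector Carrier n} {τ : Vector Carrier m} →
                (∀ i → σ (ρ i) ≡ τ i) → eval (rename ρ t) σ ≡ eval t τ
  eval-rename ρ (var i) σρ≗τ = σρ≗τ i
  eval-rename ρ (s ⊕ t) σρ≗τ = cong₂ _+_ (eval-rename ρ s σρ≗τ) (eval-rename ρ t σρ≗τ)
  eval-rename ρ (s ⊗ t) σρ≗τ = cong₂ _·_ (eval-rename ρ s σρ≗τ) (eval-rename ρ t σρ≗τ)
  eval-rename ρ (t ′)   σρ≗τ = cong _ᵅ (eval-rename ρ t σρ≗τ)
  eval-rename ρ t0      σρ≗τ = refl
  eval-rename ρ t1      σρ≗τ = refl

  eval-rename-params : ∀ {m n} (ρ : Fin m → Fin n) (t : Term (suc m))
                       {d : Vector Carrier n} {e : Vector Carrier m} →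
                       (∀ i → d (ρ i) ≡ e i) →
                       ∀ x → eval (rename (lift 1 ρ) t) (x ∷ d) ≡ eval t (x ∷ e)
  eval-rename-params ρ t {d} {e} dρ≗e x = eval-rename (lift 1 ρ) t pointwise
    where
    pointwise : ∀ i → (x ∷ d) (lift 1 ρ i) ≡ (x ∷ e) i
    pointwise zero    = refl
    pointwise (suc i) = dρ≗e i

  pol-· : ∀ {f g} → IsPol₁ 𝐀 f → IsPol₁ 𝐀 g → IsPol₁ 𝐀 (λ x → f x · g x)
  pol-· {f} {g} (n , t , e , f≗t) (m , s , d , g≗s) =
    n ℕ.+ m , t′ ⊗ s′ , e ++ d , f·g≗t′⊗s′
    where
    t′ = rename (lift 1 (_↑ˡ m)) t
    s′ = rename (lift 1 (n ↑ʳ_)) s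

    f·g≗t′⊗s′ : ∀ x → f x · g x ≡ eval (t′ ⊗ s′) (x ∷ (e ++ d))
    f·g≗t′⊗s′ x = sym (begin
      eval t′ (x ∷ (e ++ d)) · eval s′ (x ∷ (e ++ d))
        ≡⟨ cong₂ _·_ (eval-rename-params (_↑ˡ m) t (lookup-++ˡ e d) x)
                     (eval-rename-params (n ↑ʳ_) s (lookup-++ʳ e d) x) ⟩
      eval t (x ∷ e) · eval s (x ∷ d)
        ≡⟨ cong₂ _·_ (sym (f≗t x)) (sym (g≗s x)) ⟩
      f x · g x ∎)

  pol-id : IsPol₁ 𝐀 (λ x → x)
  pol-id = 0 , var zero , (λ ()) , λ x → refl

  pol-const : ∀ c → IsPol₁ 𝐀 (λ _ → c)
  pol-const c = 1 , var (suc zero) , (λ _ → c) , λ x → refl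

  pol-ᵅ : ∀ {f} → IsPol₁ 𝐀 f → IsPol₁ 𝐀 (λ x → f x ᵅ)
  pol-ᵅ (n , t , e , f≗t) = n , t ′ , e , λ x → cong _ᵅ (f≗t x)

  -- Every ideal J gives a congruence θ whose class of 0 is J; hence every
  -- ideal containing a contains I(a).
  module Congruence (J : Pred Carrier _) (J-ideal : IsIdeal 𝐀 J) where
    𝟘∈J : 𝟘 ∈ J
    𝟘∈J = proj₁ J-ideal

    I1 : ∀ a b → a · b ᵅ ∈ J → b ∈ J → a ∈ J
    I1 = proj₁ (proj₂ J-ideal)

    I2 : ∀ a b → a ᵅ · b ∈ J → b ᵅ · a ∈ J →
         ∀ c → (a · c) ᵅ · (b · c) ∈ J × (c · a) ᵅ · (c · b) ∈ J
    I2 = proj₂ (proj₂ J-ideal)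

    θ : Carrier → Carrier → Set
    θ x y = x ᵅ · y ∈ J × y ᵅ · x ∈ J

    θ-refl : ∀ x → θ x x
    θ-refl x = let xᵅx∈J = subst J (sym (·-inverseˡ x)) 𝟘∈J in xᵅx∈J , xᵅx∈J

    θ-sym : ∀ {x y} → θ x y → θ y x
    θ-sym (p , q) = q , p

    -- (I2) with c = yᵅ yields the "other" difference x yᵅ.
    θ⇒·ᵅ∈J : ∀ {x y} → θ x y → x · y ᵅ ∈ J
    θ⇒·ᵅ∈J {x} {y} (p , q) = subst J simplify (proj₁ (I2 y x q p (y ᵅ)))
      where
      simplify : (y · y ᵅ) ᵅ · (x · y ᵅ) ≡ x · y ᵅ
      simplify = trans (cong (λ w → w ᵅ · (x · y ᵅ)) (·-inverseʳ y))
                       (𝟘ᵅ-identityˡ _)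

    θ-closed : ∀ {x y} → θ x y → x ∈ J → y ∈ J
    θ-closed {x} {y} x≈y x∈J = I1 y x (θ⇒·ᵅ∈J (θ-sym x≈y)) x∈J

    θ-·ʳ : ∀ {x y} c → θ x y → θ (x · c) (y · c)
    θ-·ʳ c (p , q) = proj₁ (I2 _ _ p q c) , proj₁ (I2 _ _ q p c)

    θ-·ˡ : ∀ {x y} c → θ x y → θ (c · x) (c · y)
    θ-·ˡ c (p , q) = proj₂ (I2 _ _ p q c) , proj₂ (I2 _ _ q p c)

    θ-trans : ∀ {x y z} → θ x y → θ y z → θ x z
    θ-trans x≈y y≈z = half x≈y y≈z , half (θ-sym y≈z) (θ-sym x≈y)
      where
      half : ∀ {x y z} → θ x y → θ y z → x ᵅ · z ∈ J
      half {x} (p , _) y≈z = θ-closed (θ-·ˡ (x ᵅ) y≈z) p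

    θ-ᵅ : ∀ {x y} → θ x y → θ (x ᵅ) (y ᵅ)
    θ-ᵅ {x} {y} x≈y =
        subst (λ w → w · y ᵅ ∈ J) (sym (ᵅ-involutive x)) (θ⇒·ᵅ∈J x≈y)
      , subst (λ w → w · x ᵅ ∈ J) (sym (ᵅ-involutive y)) (θ⇒·ᵅ∈J (θ-sym x≈y))

    θ-· : ∀ {x x′ y y′} → θ x x′ → θ y y′ → θ (x · y) (x′ · y′)
    θ-· {x′ = x′} {y = y} x≈x′ y≈y′ = θ-trans (θ-·ʳ y x≈x′) (θ-·ˡ x′ y≈y′)

    -- Compatibility with + follows from the join formula.
    θ-+ʳ : ∀ {x x′} y → θ x x′ → θ (x + y) (x′ + y)
    θ-+ʳ {x} {x′} y x≈x′ = subst₂ θ (sym (join-formula x y)) (sym (join-formula x′ y))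
      (θ-ᵅ (θ-·ʳ (y ᵅ) (θ-ᵅ (θ-·ʳ (y ᵅ) x≈x′))))

    θ-+ : ∀ {x x′ y y′} → θ x x′ → θ y y′ → θ (x + y) (x′ + y′)
    θ-+ {x′ = x′} {y = y} {y′ = y′} x≈x′ y≈y′ = θ-trans (θ-+ʳ y x≈x′)
      (subst₂ θ (+-comm y x′) (+-comm y′ x′) (θ-+ʳ x′ y≈y′))

    θ-eval : ∀ {n} (t : Term n) {ρ σ : Vector Carrier n} →
             (∀ i → θ (ρ i) (σ i)) → θ (eval t ρ) (eval t σ)
    θ-eval (var i) ρ≈σ = ρ≈σ i
    θ-eval (s ⊕ t) ρ≈σ = θ-+ (θ-eval s ρ≈σ) (θ-eval t ρ≈σ)
    θ-eval (s ⊗ t) ρ≈σ = θ-· (θ-eval s ρ≈σ) (θ-eval t ρ≈σ)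
    θ-eval (t ′)   ρ≈σ = θ-ᵅ (θ-eval t ρ≈σ)
    θ-eval t0      ρ≈σ = θ-refl 𝟘
    θ-eval t1      ρ≈σ = θ-refl 𝟙

    θ-pol : ∀ {p x y} → IsPol₁ 𝐀 p → θ x y → θ (p x) (p y)
    θ-pol {p} {x} {y} (n , t , e , p≗t) x≈y =
      subst₂ θ (sym (p≗t x)) (sym (p≗t y)) (θ-eval t pointwise)
      where
      pointwise : ∀ i → θ ((x ∷ e) i) ((y ∷ e) i)
      pointwise zero    = x≈y
      pointwise (suc i) = θ-refl (e i)

    ∈J⇒θ𝟘 : ∀ {a} → a ∈ J → θ a 𝟘
    ∈J⇒θ𝟘 {a} a∈J = subst J (sym (·-zeroʳ (a ᵅ))) 𝟘∈J
                  , subst J (sym (𝟘ᵅ-identityˡ a)) a∈J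

    PolSet⊆ : ∀ {a} → a ∈ J → PolSet 𝐀 a ⊆ J
    PolSet⊆ a∈J (p , p-pol , p𝟘≡𝟘 , pa≡y) =
      θ-closed (subst₂ θ p𝟘≡𝟘 pa≡y (θ-sym (θ-pol p-pol (∈J⇒θ𝟘 a∈J)))) 𝟘∈J

  module PolSetIdeal (a : Carrier) where
    I : Pred Carrier _
    I = PolSet 𝐀 a

    ∈I : ∀ {f y} → IsPol₁ 𝐀 f → f 𝟘 ≡ 𝟘 → f a ≡ y → y ∈ I
    ∈I f-pol f𝟘≡𝟘 fa≡y = _ , f-pol , f𝟘≡𝟘 , fa≡y

    𝟘∈I : 𝟘 ∈ I
    𝟘∈I = ∈I (pol-const 𝟘) refl refl

    a∈I : a ∈ I
    a∈I = ∈I pol-id refl refl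

    -- (I1): from p(a) = y zᵅ and q(a) = z, the polynomial
    -- x ↦ y (y (p(x)ᵅ q(x)ᵅ))ᵅ vanishes at 0 and takes the value y at a.
    I-I1 : ∀ y z → y · z ᵅ ∈ I → z ∈ I → y ∈ I
    I-I1 y z (p , p-pol , p𝟘≡𝟘 , pa≡yzᵅ) (q , q-pol , q𝟘≡𝟘 , qa≡z) =
      ∈I (pol-· (pol-const y) (pol-ᵅ (pol-· (pol-const y)
           (pol-· (pol-ᵅ p-pol) (pol-ᵅ q-pol)))))
         at𝟘 at-a
      where
      at𝟘 : y · (y · (p 𝟘 ᵅ · q 𝟘 ᵅ)) ᵅ ≡ 𝟘
      at𝟘 = begin
        y · (y · (p 𝟘 ᵅ · q 𝟘 ᵅ)) ᵅ
          ≡⟨ cong (λ w → y · (y · w) ᵅ) (cong₂ (λ u v → u ᵅ · v ᵅ) p𝟘≡𝟘 q𝟘≡𝟘) ⟩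
        y · (y · (𝟘 ᵅ · 𝟘 ᵅ)) ᵅ  ≡⟨ cong (λ w → y · (y · w) ᵅ) (𝟘ᵅ-identityˡ (𝟘 ᵅ)) ⟩
        y · (y · 𝟘 ᵅ) ᵅ         ≡⟨ cong (λ w → y · (y · w) ᵅ) 𝟘ᵅ≡𝟙 ⟩
        y · (y · 𝟙) ᵅ           ≡⟨ cong (λ w → y · w ᵅ) (·-identityʳ y) ⟩
        y · y ᵅ                 ≡⟨ ·-inverseʳ y ⟩
        𝟘                       ∎
      at-a : y · (y · (p a ᵅ · q a ᵅ)) ᵅ ≡ y
      at-a = begin
        y · (y · (p a ᵅ · q a ᵅ)) ᵅ
          ≡⟨ cong (λ w → y · (y · w) ᵅ) (cong₂ (λ u v → u ᵅ · v ᵅ) pa≡yzᵅ qa≡z) ⟩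
        y · (y · ((y · z ᵅ) ᵅ · z ᵅ)) ᵅ  ≡⟨ cong (λ w → y · (y · w) ᵅ) (sym (ᵅ-join y z)) ⟩
        y · (y · (y + z) ᵅ) ᵅ            ≡⟨ cong (λ w → y · w ᵅ) (≤⇒·ᵅ≡𝟘 (x≤x+y y z)) ⟩
        y · 𝟘 ᵅ                          ≡⟨ cong (y ·_) 𝟘ᵅ≡𝟙 ⟩
        y · 𝟙                            ≡⟨ ·-identityʳ y ⟩
        y                                ∎

    -- Transfer: if two polynomials agree at a and g vanishes at 0, then
    -- f(0) ∈ I.  (Apply (I1) to f(0)·g(a)ᵅ, the value at a of the
    -- polynomial x ↦ f(0) g(x)ᵅ, which vanishes at 0 as f(a) = g(a).)
    transfer : ∀ {f g y} → IsPol₁ 𝐀 f → IsPol₁ 𝐀 g →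
               f a ≡ g a → g 𝟘 ≡ 𝟘 → f 𝟘 ≡ y → y ∈ I
    transfer {f} {g} {y} f-pol g-pol fa≡ga g𝟘≡𝟘 f𝟘≡y =
      I-I1 y (g a) yga∈I (∈I g-pol g𝟘≡𝟘 refl)
      where
      yga∈I : y · g a ᵅ ∈ I
      yga∈I = ∈I (pol-· (pol-const y) (pol-ᵅ f-pol))
                 (trans (cong (λ w → y · w ᵅ) f𝟘≡y) (·-inverseʳ y))
                 (cong (λ w → y · w ᵅ) fa≡ga)

    -- (I2), for an arbitrary polynomial context h with h(v) = 0: from
    -- p(a) = uᵅv and q(a) = vᵅu, the polynomials h((q x)ᵅ u) and
    -- h((p x)ᵅ v) agree at a by the Łukasiewicz identity, and take the
    -- values h(u) and h(v) = 0 at 0.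
    I-I2-context : ∀ {u v} → u ᵅ · v ∈ I → v ᵅ · u ∈ I →
                   (h : Carrier → Carrier) →
                   (∀ {r} → IsPol₁ 𝐀 r → IsPol₁ 𝐀 (h ∘ r)) →
                   h v ≡ 𝟘 → h u ∈ I
    I-I2-context {u} {v} (p , p-pol , p𝟘≡𝟘 , pa≡uᵅv) (q , q-pol , q𝟘≡𝟘 , qa≡vᵅu)
                 h h-pol hv≡𝟘 =
      transfer (h-pol (pol-· (pol-ᵅ q-pol) (pol-const u)))
               (h-pol (pol-· (pol-ᵅ p-pol) (pol-const v)))
               agree-at-a
               (trans (cong h (at𝟘 p𝟘≡𝟘)) hv≡𝟘)
               (cong h (at𝟘 q𝟘≡𝟘))
      where
      at𝟘 : ∀ {c w} → c ≡ 𝟘 → c ᵅ · w ≡ w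
      at𝟘 {w = w} c≡𝟘 = trans (cong (λ s → s ᵅ · w) c≡𝟘) (𝟘ᵅ-identityˡ w)

      agree-at-a : h (q a ᵅ · u) ≡ h (p a ᵅ · v)
      agree-at-a = cong h (begin
        q a ᵅ · u            ≡⟨ cong (λ s → s ᵅ · u) qa≡vᵅu ⟩
        (v ᵅ · u) ᵅ · u      ≡⟨ łuk-ᵅ v u ⟩
        (u ᵅ · v) ᵅ · v      ≡⟨ cong (λ s → s ᵅ · v) (sym pa≡uᵅv) ⟩
        p a ᵅ · v            ∎)

    -- (I2) proper: both required elements are h(u) for contexts h with h(v) = 0.
    I-I2 : ∀ u v → u ᵅ · v ∈ I → v ᵅ · u ∈ I →
           ∀ c → (u · c) ᵅ · (v · c) ∈ I × (c · u) ᵅ · (c · v) ∈ I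
    I-I2 u v uᵅv∈I vᵅu∈I c =
        I-I2-context uᵅv∈I vᵅu∈I (λ w → (w · c) ᵅ · (v · c))
          (λ r-pol → pol-· (pol-ᵅ (pol-· r-pol (pol-const c))) (pol-const (v · c)))
          (·-inverseˡ (v · c))
      , I-I2-context uᵅv∈I vᵅu∈I (λ w → (c · w) ᵅ · (c · v))
          (λ r-pol → pol-· (pol-ᵅ (pol-· (pol-const c) r-pol)) (pol-const (c · v)))
          (·-inverseˡ (c · v))

theorem5 : (𝐀 : ŁukNearSemiring) (a : ŁukNearSemiring.Carrier 𝐀) →
           IsLeastIdealContaining 𝐀 a (PolSet 𝐀 a)
theorem5 𝐀 a = (𝟘∈I , I-I1 , I-I2) , a∈I ,
               λ J J-ideal a∈J → Congruence.PolSet⊆ 𝐀 J J-ideal a∈J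
  where open PolSetIdeal 𝐀 a
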